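{- Let $G$ be a finite undirected graph whose vertex set is partitioned into two sets $S$ and $Y$, and let $\mathcal{F}=(P_1,\dots,P_{2|Y|+1})$ be a sequence of (not necessarily distinct) directed $S$–$S$ paths in $G$. Then there exists a directed $S$–$S$ path in $G$ that is rainbow-monotone with respect to $\mathcal{F}$.
   Context: Paths are (simple) paths in the undirected graph $G$, traversed in a chosen direction; $in(P)$ and $ter(P)$ denote the initial and terminal vertices of a directed path $P$. A directed $S$–$S$ path is a directed path $P$ (with at least one edge) with $in(P),ter(P)\in S$ and $V(P)\cap S=\{in(P),ter(P)\}$. Given an ordered family $\mathcal{F}=(P_1,\dots,P_m)$ of directed paths, a directed path $P$ whose edges, in the order of $P$, are $e_1,\dots,e_k$ is rainbow-monotone with respect to $\mathcal{F}$ if there are indices $j_1<j_2<\dots<j_k$ with $e_i\in E(P_{j_i})$ for every $i$. -}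

module Defs where

open import Data.Nat using (ℕ; _≤_)
open import Data.Bool using (Bool; true; false)
open import Data.Fin using (Fin) renaming (_<_ to _<ᶠ_)
open import Data.Fin.Subset using (Subset) renaming (_∈_ to _∈ˢ_; _∉_ to _∉ˢ_)
open import Data.List using (List; []; _∷_; _++_; length)
open import Data.List.Membership.Propositional using (_∈_)
open import Data.List.Relation.Unary.All using (All)
open import Data.List.Relation.Unary.Unique.Propositional using (Unique)
open import Data.List.Relation.Unary.Linked using (Linked)
open import Data.List.Relation.Binary.Pointwise using (Pointwise)
open import Data.Product using (Σ; ∃; ∃-syntax; _×_; _,_)
open import Data.Sum using (_⊎_)
open import Relation.Binary.PropositionalEquality using (_≡_)

record Graph (n : ℕ) : Set where
  field
    adj    : Fin n → Fin n → Bool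
    sym    : ∀ u v → adj u v ≡ adj v u
    irrefl : ∀ v → adj v v ≡ false
open Graph public

edgesOf : ∀ {A : Set} → List A → List (A × A)
edgesOf (x ∷ y ∷ xs) = (x , y) ∷ edgesOf (y ∷ xs)
edgesOf _ = []

IsDPath : ∀ {n} → Graph n → List (Fin n) → Set
IsDPath G vs =
  Unique vs × 2 ≤ length vs × All (λ e → adj G (Data.Product.proj₁ e) (Data.Product.proj₂ e) ≡ true) (edgesOf vs)

IsSSPath : ∀ {n} → Graph n → Subset n → List (Fin n) → Set
IsSSPath {n} G S vs =
  IsDPath G vs ×
  ∃[ u ] ∃[ mid ] ∃[ w ] (vs ≡ u ∷ mid ++ w ∷ []) × u ∈ˢ S × w ∈ˢ S × All (λ x → x ∉ˢ S) mid

_∈E_ : ∀ {n} → Fin n × Fin n → List (Fin n) → Set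
(u , v) ∈E P = (u , v) ∈ edgesOf P ⊎ (v , u) ∈ edgesOf P

-- P (edges e_1..e_k in order) is rainbow-monotone w.r.t. F = (F_0,...,F_{m-1}):
-- there are indices j_1 < ... < j_k with e_i ∈ E(F_{j_i}).
RainbowMonotone : ∀ {n m} → (Fin m → List (Fin n)) → List (Fin n) → Set
RainbowMonotone {n} {m} F P =
  ∃[ js ] Linked _<ᶠ_ js × Pointwise (λ e j → e ∈E F j) (edgesOf P) js

{-# OPTIONS --safe #-}
module Submission where

-- Work backwards through the family. After processing P_m, …, P_{k+1}, remember for
-- every vertex y ∈ Y up to two distinct vertices s ∈ S that y reaches by a path through
-- Y which is rainbow-monotone using only colours > k. Processing P_k = u y₁ … y_r w
-- from w back to y₁, each yᵢ either learns a new target (the potential, the total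
-- number of known targets, grows) or already reaches a target different from u, which
-- can then be pushed back along P_k to y₁; prepending the edge u y₁ of colour k gives a
-- rainbow-monotone S–S path. The potential never exceeds 2|Y|, so it cannot grow at
-- each of 2|Y| + 1 steps, and some step yields the path.

open import Defs hiding (sym)
open import Data.Nat using (+-0-rawMonoid; ℕ; zero; suc; _+_; _*_; z≤n; s≤s) renaming (_≤_ to _≤ₙ_; _<_ to _<ₙ_)
open import Algebra.Definitions.RawMonoid +-0-rawMonoid using (sum)
open import Data.Nat.Properties
  using (≤-refl; ≤-trans; ≤-reflexive; ≤-<-trans; <⇒≤; <⇒≱; n≤1+n; m≤n+m; m<m+n;
         +-mono-≤; +-mono-<-≤; +-mono-≤-<; +-identityʳ; +-suc; *-suc)
open import Data.Fin using (Fin; zero; suc; toℕ; fromℕ<) renaming (_<_ to _<ᶠ_; _≟_ to _≟ᶠ_)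
open import Data.Fin.Properties using (toℕ-fromℕ<)
open import Data.Fin.Subset using (Subset; ∁; ∣_∣) renaming (_∈_ to _∈ˢ_; _∉_ to _∉ˢ_)
open import Data.Vec using ([]; _∷_)
open import Data.Vec.Base using (here; there)
open import Data.Vec.Functional using (Vector)
open import Data.List using (List; []; _∷_; _++_)
open import Data.List.Membership.Propositional using (_∈_; _∉_)
open import Data.List.Membership.Propositional.Properties using (∈-++⁻; ∈-++⁺ʳ)
import Data.List.Membership.DecPropositional as DecMembership
open import Data.List.Relation.Unary.Any using (here; there)
open import Data.List.Relation.Unary.All using (All; []; _∷_; lookup)
open import Data.List.Relation.Unary.All.Properties using (¬Any⇒All¬)
open import Data.List.Relation.Unary.AllPairs using ([]; _∷_)
open import Data.List.Relation.Unary.Unique.Propositional using (Unique)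
open import Data.List.Relation.Unary.Linked using (Linked; [-]; _∷_)
open import Data.List.Relation.Binary.Pointwise using (Pointwise; []; _∷_)
open import Data.Product using (Σ; ∃; ∃₂; ∃-syntax; _×_; _,_; proj₁; proj₂)
open import Data.Sum using (_⊎_; inj₁; inj₂; map₂)
open import Data.Empty using (⊥-elim)
open import Data.Bool using (true; false)
open import Relation.Nullary using (yes; no)
open import Relation.Binary.PropositionalEquality using (_≡_; _≢_; refl; sym; trans; cong; subst)

sum-mono-≤ : ∀ {k} {f g : Vector ℕ k} → (∀ i → f i ≤ₙ g i) → sum f ≤ₙ sum g
sum-mono-≤ {zero} f≤g = z≤n
sum-mono-≤ {suc k} f≤g = +-mono-≤ (f≤g zero) (sum-mono-≤ (λ i → f≤g (suc i)))

sum-mono-< : ∀ {k} {f g : Vector ℕ k} → (∀ i → f i ≤ₙ g i) → ∀ i → f i <ₙ g i → sum f <ₙ sum g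
sum-mono-< f≤g zero    f<g = +-mono-<-≤ f<g (sum-mono-≤ (λ i → f≤g (suc i)))
sum-mono-< f≤g (suc i) f<g = +-mono-≤-< (f≤g zero) (sum-mono-< (λ i → f≤g (suc i)) i f<g)

sum-≤-*-∣∁∣ : ∀ {k} (S : Subset k) {c} {f : Vector ℕ k} →
              (∀ i → f i ≤ₙ c) → (∀ i → i ∈ˢ S → f i ≡ 0) → sum f ≤ₙ c * ∣ ∁ S ∣
sum-≤-*-∣∁∣ []          f≤c f≡0 = z≤n
sum-≤-*-∣∁∣ (true ∷ S)  f≤c f≡0 rewrite f≡0 zero here =
  sum-≤-*-∣∁∣ S (λ i → f≤c (suc i)) (λ i i∈S → f≡0 (suc i) (there i∈S))
sum-≤-*-∣∁∣ (false ∷ S) {c} f≤c f≡0 rewrite *-suc c ∣ ∁ S ∣ =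
  +-mono-≤ (f≤c zero) (sum-≤-*-∣∁∣ S (λ i → f≤c (suc i)) (λ i i∈S → f≡0 (suc i) (there i∈S)))

ends-distinct : ∀ {A : Set} {u w : A} mid → Unique (u ∷ mid ++ w ∷ []) → w ≢ u
ends-distinct mid (u∉ ∷ _) w≡u = lookup u∉ (∈-++⁺ʳ mid (here refl)) (sym w≡u)

module Rainbow {n} (G : Graph n) (S : Subset n) {m} (F : Fin m → List (Fin n))
               (F-SS : ∀ j → IsSSPath G S (F j)) where

  open DecMembership (_≟ᶠ_ {n}) using () renaming (_∈?_ to _∈ᴸ?_)

  RainbowSSPath : Set
  RainbowSSPath = ∃[ P ] (IsSSPath G S P × RainbowMonotone F P)

  ∈E⇒adj : ∀ {a b} j → (a , b) ∈E F j → adj G a b ≡ true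
  ∈E⇒adj j (inj₁ e)          = lookup (proj₂ (proj₂ (proj₁ (F-SS j)))) e
  ∈E⇒adj {a} {b} j (inj₂ e) = trans (Graph.sym G a b) (lookup (proj₂ (proj₂ (proj₁ (F-SS j)))) e)

  -- y ∷ rest is a path through Y ending in s ∈ S, rainbow-monotone with first colour j.
  data Tail : Fin n → List (Fin n) → Fin n → Fin m → Set where
    edge : ∀ {y s j} → y ∉ˢ S → s ∈ˢ S → adj G y s ≡ true → (y , s) ∈E F j → Tail y (s ∷ []) s j
    cons : ∀ {a y rest s j j'} → a ∉ˢ S → a ∉ (y ∷ rest) → adj G a y ≡ true → (a , y) ∈E F j →
           j <ᶠ j' → Tail y rest s j' → Tail a (y ∷ rest) s j

  tail-head-∉S : ∀ {y rest s j} → Tail y rest s j → y ∉ˢ S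
  tail-head-∉S (edge y∉S _ _ _)     = y∉S
  tail-head-∉S (cons a∉S _ _ _ _ _) = a∉S

  record TailProperties (y : Fin n) (rest : List (Fin n)) (s : Fin n) (j : Fin m) : Set where
    field
      unique   : Unique (y ∷ rest)
      adjacent : All (λ e → adj G (proj₁ e) (proj₂ e) ≡ true) (edgesOf (y ∷ rest))
      mid      : List (Fin n)
      shape    : rest ≡ mid ++ s ∷ []
      mid-∉S   : All (_∉ˢ S) (y ∷ mid)
      end-∈S   : s ∈ˢ S
      colours  : List (Fin m)
      linked   : Linked _<ᶠ_ (j ∷ colours)
      coloured : Pointwise (λ e j → e ∈E F j) (edgesOf (y ∷ rest)) (j ∷ colours)

  tail-properties : ∀ {y rest s j} → Tail y rest s j → TailProperties y rest s j
  tail-properties (edge y∉S s∈S y~s e) = record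
    { unique = ((λ y≡s → y∉S (subst (_∈ˢ S) (sym y≡s) s∈S)) ∷ []) ∷ [] ∷ []
    ; adjacent = y~s ∷ [] ; mid = [] ; shape = refl ; mid-∉S = y∉S ∷ [] ; end-∈S = s∈S
    ; colours = [] ; linked = [-] ; coloured = e ∷ [] }
  tail-properties (cons {j' = j'} a∉S a∉rest a~y e j<j' tl) = let open TailProperties (tail-properties tl) in record
    { unique = ¬Any⇒All¬ _ a∉rest ∷ unique ; adjacent = a~y ∷ adjacent ; mid = _ ∷ mid
    ; shape = cong (_ ∷_) shape ; mid-∉S = a∉S ∷ mid-∉S ; end-∈S = end-∈S
    ; colours = j' ∷ colours ; linked = j<j' ∷ linked ; coloured = e ∷ coloured }

  tail-∈S⇒≡end : ∀ {y rest s j x} → Tail y rest s j → x ∈ (y ∷ rest) → x ∈ˢ S → x ≡ s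
  tail-∈S⇒≡end {y} tl x∈ x∈S with ∈-++⁻ (y ∷ mid) (subst (λ r → _ ∈ y ∷ r) shape x∈)
    where open TailProperties (tail-properties tl)
  ... | inj₁ x∈mid     = ⊥-elim (lookup (TailProperties.mid-∉S (tail-properties tl)) x∈mid x∈S)
  ... | inj₂ (here x≡s) = x≡s

  source-∷-tail : ∀ {u y rest s j} (t : Fin m) → u ∈ˢ S → u ≢ s → (u , y) ∈E F t → t <ᶠ j →
                  Tail y rest s j → RainbowSSPath
  source-∷-tail {u} {y} {rest} {s} {j} t u∈S u≢s e t<j tl =
    u ∷ y ∷ rest ,
    ((¬Any⇒All¬ _ (λ u∈ → u≢s (tail-∈S⇒≡end tl u∈ u∈S)) ∷ unique , s≤s (s≤s z≤n) , ∈E⇒adj t e ∷ adjacent) ,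
      u , y ∷ mid , s , cong (λ r → u ∷ y ∷ r) shape , u∈S , end-∈S , mid-∉S) ,
    t ∷ j ∷ colours , t<j ∷ linked , e ∷ coloured
    where open TailProperties (tail-properties tl)

  tail-suffix : ∀ {y rest s j x} → x ∉ˢ S → x ∈ (y ∷ rest) → Tail y rest s j →
                ∃₂ λ rest' j' → toℕ j ≤ₙ toℕ j' × Tail x rest' s j'
  tail-suffix x∉S (here refl)         tl                  = _ , _ , ≤-refl , tl
  tail-suffix x∉S (there (here refl)) (edge _ s∈S _ _)    = ⊥-elim (x∉S s∈S)
  tail-suffix x∉S (there (there ()))  (edge _ _ _ _)
  tail-suffix x∉S (there x∈)          (cons _ _ _ _ j<j' tl) with tail-suffix x∉S x∈ tl
  ... | rest' , j'' , j'≤j'' , tl' = rest' , j'' , ≤-trans (<⇒≤ j<j') j'≤j'' , tl'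

  Reaches : ℕ → Fin n → Fin n → Set
  Reaches b v s = ∃₂ λ rest j → b ≤ₙ toℕ j × Tail v rest s j

  Reaches-weaken : ∀ {b b' v s} → b' ≤ₙ b → Reaches b v s → Reaches b' v s
  Reaches-weaken b'≤b (rest , j , b≤j , tl) = rest , j , ≤-trans b'≤b b≤j , tl

  data Targets (b : ℕ) (v : Fin n) : Set where
    none : Targets b v
    one  : ∀ s → Reaches b v s → Targets b v
    two  : ∀ s s' → s ≢ s' → Reaches b v s → Reaches b v s' → Targets b v

  count : ∀ {b v} → Targets b v → ℕ
  count none              = 0
  count (one _ _)         = 1
  count (two _ _ _ _ _)   = 2

  Targets-weaken : ∀ {b b' v} → b' ≤ₙ b → Targets b v → Targets b' v
  Targets-weaken b'≤b none              = none
  Targets-weaken b'≤b (one s r)         = one s (Reaches-weaken b'≤b r)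
  Targets-weaken b'≤b (two s s' s≢s' r r') = two s s' s≢s' (Reaches-weaken b'≤b r) (Reaches-weaken b'≤b r')

  count-weaken : ∀ {b b' v} (b'≤b : b' ≤ₙ b) (ts : Targets b v) → count (Targets-weaken b'≤b ts) ≡ count ts
  count-weaken _ none            = refl
  count-weaken _ (one _ _)       = refl
  count-weaken _ (two _ _ _ _ _) = refl

  count≤2 : ∀ {b v} (ts : Targets b v) → count ts ≤ₙ 2
  count≤2 none            = z≤n
  count≤2 (one _ _)       = s≤s z≤n
  count≤2 (two _ _ _ _ _) = ≤-refl

  count-∈S : ∀ {b v} (ts : Targets b v) → v ∈ˢ S → count ts ≡ 0
  count-∈S none                           v∈S = refl
  count-∈S (one _ (_ , _ , _ , tl))       v∈S = ⊥-elim (tail-head-∉S tl v∈S)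
  count-∈S (two _ _ _ (_ , _ , _ , tl) _) v∈S = ⊥-elim (tail-head-∉S tl v∈S)

  Knowledge : ℕ → Set
  Knowledge b = (v : Fin n) → Targets b v

  potential : ∀ {b} → Knowledge b → ℕ
  potential kn = sum (λ v → count (kn v))

  potential≤2*∣∁S∣ : ∀ {b} (kn : Knowledge b) → potential kn ≤ₙ 2 * ∣ ∁ S ∣
  potential≤2*∣∁S∣ kn = sum-≤-*-∣∁∣ S (λ v → count≤2 (kn v)) (λ v → count-∈S (kn v))

  module Step (k : ℕ) (k<m : k <ₙ m) (kn : Knowledge (suc k)) where

    t : Fin m
    t = fromℕ< k<m

    k≤t : k ≤ₙ toℕ t
    k≤t = ≤-reflexive (sym (toℕ-fromℕ< k<m))

    t<ᶠ : ∀ {j : Fin m} → suc k ≤ₙ toℕ j → t <ᶠ j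
    t<ᶠ {j} = subst (λ i → suc i ≤ₙ toℕ j) (sym (toℕ-fromℕ< k<m))

    Progress : Set
    Progress = Σ (Knowledge k) λ kn' → potential kn <ₙ potential kn'

    update : (x : Fin n) → Targets k x → Knowledge k
    update x ts v with v ≟ᶠ x
    ... | yes refl = ts
    ... | no _     = Targets-weaken (n≤1+n k) (kn v)

    update-progress : (x : Fin n) (ts : Targets k x) → count (kn x) <ₙ count ts → Progress
    update-progress x ts lt = update x ts , sum-mono-< count-≤ x (subst (count (kn x) <ₙ_) (sym count-x) lt)
      where
        count-≤ : ∀ v → count (kn v) ≤ₙ count (update x ts v)
        count-≤ v with v ≟ᶠ x
        ... | yes refl = <⇒≤ lt
        ... | no _     = ≤-reflexive (sym (count-weaken (n≤1+n k) (kn v)))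

        count-x : count (update x ts x) ≡ count ts
        count-x with x ≟ᶠ x
        ... | yes refl = refl
        ... | no x≢x   = ⊥-elim (x≢x refl)

    -- An existing tail is reused when x already lies on it, so paths stay simple.
    push-back : ∀ {x y s} → x ∉ˢ S → (x , y) ∈E F t → Reaches (suc k) y s → Reaches k x s
    push-back {x} {y} x∉S e (rest , j , k<j , tl) with x ∈ᴸ? (y ∷ rest)
    ... | yes x∈ with tail-suffix x∉S x∈ tl
    ...   | rest' , j' , j≤j' , tl' = rest' , j' , ≤-trans (n≤1+n k) (≤-trans k<j j≤j') , tl'
    push-back {x} {y} x∉S e (rest , j , k<j , tl) | no x∉ =
      y ∷ rest , t , k≤t , cons x∉S x∉ (∈E⇒adj t e) e (t<ᶠ k<j) tl

    AvoidsTarget : Fin n → Fin n → Set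
    AvoidsTarget u x = ∃ λ s → s ≢ u × Reaches (suc k) x s

    learn : (u x s : Fin n) → s ≢ u → Reaches k x s → Progress ⊎ AvoidsTarget u x
    learn u x s s≢u r with kn x in kn-x
    ... | none = inj₁ (update-progress x (one s r) (subst (λ ts → count ts <ₙ 1) (sym kn-x) (s≤s z≤n)))
    ... | one s' r' with s' ≟ᶠ u
    ...   | no s'≢u  = inj₂ (s' , s'≢u , r')
    ...   | yes refl = inj₁ (update-progress x (two s' s (λ u≡s → s≢u (sym u≡s)) (Reaches-weaken (n≤1+n k) r') r)
                                             (subst (λ ts → count ts <ₙ 2) (sym kn-x) ≤-refl))
    learn u x s s≢u r | two s₁ s₂ s₁≢s₂ r₁ r₂ with s₁ ≟ᶠ u
    ...   | no s₁≢u  = inj₂ (s₁ , s₁≢u , r₁)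
    ...   | yes refl = inj₂ (s₂ , (λ s₂≡s₁ → s₁≢s₂ (sym s₂≡s₁)) , r₂)

    scan : (u w : Fin n) → w ∈ˢ S → w ≢ u → (x : Fin n) (xs : List (Fin n)) → x ∉ˢ S → All (_∉ˢ S) xs →
           (∀ {e} → e ∈ edgesOf (x ∷ xs ++ w ∷ []) → e ∈ edgesOf (F t)) → Progress ⊎ AvoidsTarget u x
    scan u w w∈S w≢u x [] x∉S _ ⊆Ft =
      learn u x w w≢u (w ∷ [] , t , k≤t , edge x∉S w∈S (∈E⇒adj t e) e)
      where e = inj₁ (⊆Ft (here refl))
    scan u w w∈S w≢u x (y ∷ ys) x∉S (y∉S ∷ ys∉S) ⊆Ft with scan u w w∈S w≢u y ys y∉S ys∉S (λ e∈ → ⊆Ft (there e∈))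
    ... | inj₁ progress       = inj₁ progress
    ... | inj₂ (s , s≢u , r) = learn u x s s≢u (push-back x∉S (inj₁ (⊆Ft (here refl))) r)

    step : RainbowSSPath ⊎ Progress
    step with F-SS t
    ... | (uq , _ , _) , u , [] , w , Ft≡ , u∈S , w∈S , _ =
      inj₁ (F t , F-SS t , t ∷ [] , [-] ,
        subst (λ P → Pointwise (λ e j → e ∈E F j) (edgesOf P) (t ∷ [])) (sym Ft≡)
          (inj₁ (subst (λ P → (u , w) ∈ edgesOf P) (sym Ft≡) (here refl)) ∷ []))
    ... | (uq , _ , _) , u , y ∷ ys , w , Ft≡ , u∈S , w∈S , y∉S ∷ ys∉S
      with scan u w w∈S (ends-distinct (y ∷ ys) (subst Unique Ft≡ uq)) y ys y∉S ys∉S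
                (λ e∈ → subst (λ P → _ ∈ edgesOf P) (sym Ft≡) (there e∈))
    ... | inj₁ progress = inj₂ progress
    ... | inj₂ (s , s≢u , (rest , j , k<j , tl)) =
      inj₁ (source-∷-tail t u∈S (λ u≡s → s≢u (sym u≡s))
              (inj₁ (subst (λ P → (u , y) ∈ edgesOf P) (sym Ft≡) (here refl))) (t<ᶠ k<j) tl)

  search : (d k : ℕ) → d + k ≡ m → RainbowSSPath ⊎ Σ (Knowledge k) λ kn → d ≤ₙ potential kn
  search zero    k _     = inj₂ ((λ _ → none) , z≤n)
  search (suc d) k d+k≡m with search d (suc k) (trans (+-suc d k) d+k≡m)
  ... | inj₁ sol          = inj₁ sol
  ... | inj₂ (kn , d≤pot) =
    map₂ (λ (kn' , lt) → kn' , ≤-<-trans d≤pot lt) (Step.step k (subst (suc k ≤ₙ_) d+k≡m (s≤s (m≤n+m k d))) kn)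

  rainbow-SS-path : 2 * ∣ ∁ S ∣ <ₙ m → RainbowSSPath
  rainbow-SS-path 2∣Y∣<m with search m 0 (+-identityʳ m)
  ... | inj₁ sol          = sol
  ... | inj₂ (kn , m≤pot) = ⊥-elim (<⇒≱ 2∣Y∣<m (≤-trans m≤pot (potential≤2*∣∁S∣ kn)))

theorem1p8 : (n : ℕ) (G : Graph n) (S : Subset n)
             (F : Fin (2 * ∣ ∁ S ∣ + 1) → List (Fin n)) →
             (∀ j → IsSSPath G S (F j)) →
             ∃[ P ] (IsSSPath G S P × RainbowMonotone F P)
theorem1p8 n G S F F-SS = Rainbow.rainbow-SS-path G S F F-SS (m<m+n (2 * ∣ ∁ S ∣) (s≤s z≤n))
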